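{- Let $G$ be a graph without isolated vertices, let $Y$ be a uniform NFBDD realizing $\phi(G)$, let $a$ be a node of $Y$, and let $P_1$ be a path from the root of $Y$ to $a$. Let $Vrt=\{v: x_v\text{ or }\neg x_v\in A(P_1)\}$ and $Vng(P_1)=\{v:\neg x_v\in A(P_1)\}$. Then $\mathrm{Free}_a=V(G)\setminus\big(Vrt\cup N_G(Vng(P_1))\big)$, where $N_G(X)$ is the set of vertices adjacent to some vertex of $X$.
   Context: $\phi(G)$ is the monotone 2-CNF with variables $\{x_v: v\in V(G)\}$ and clauses $(x_u\vee x_v)$ for $\{u,v\}\in E(G)$. An NROBP realizing $F$ is a connected DAG (multiple edges allowed) with one root and one leaf, some edges labelled by literals, no directed path containing two edges labelled by literals of the same variable; with $A(P)$ the literals on $P$, every extension of $A(P)$ for a root-to-leaf $P$ satisfies $F$ and every satisfying assignment contains some such $A(P)$. Uniform: paths from the root to the same node carry literals of the same variable set, and root-to-leaf paths carry literals of all variables. An NFBDD is an NROBP in which every edge is labelled, every node has out-degree at most $2$, and the two out-edges of a node of out-degree $2$ are labelled by opposite literals of the same variable. $\mathrm{Vert}_a$ is the set of $v\in V(G)$ such that $x_v$ does not occur on paths from the root to $a$; $\mathrm{Free}_a$ is the set of $v\in\mathrm{Vert}_a$ such that $\neg x_v$ labels an edge of some path from $a$ to the leaf. -}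

module Defs where

open import Data.Nat using (ℕ; _<_)
open import Data.Fin using (Fin; toℕ)
open import Data.Bool using (Bool; true; false; not)
open import Data.Maybe using (Maybe; just; nothing)
open import Data.Product using (Σ; ∃; ∃-syntax; _×_; _,_; proj₁; proj₂)
open import Data.Sum using (_⊎_)
open import Data.Empty using (⊥)
open import Data.List using (List; []; _∷_; map)
open import Data.List.Membership.Propositional using (_∈_; _∉_)
open import Data.List.Relation.Unary.All using (All)
open import Data.List.Relation.Unary.Unique.Propositional using (Unique)
open import Relation.Nullary using (¬_)
open import Relation.Binary.PropositionalEquality using (_≡_; _≢_)
open import Function.Bundles using (_⇔_)

record Graph (n : ℕ) : Set₁ where
  field
    Adj     : Fin n → Fin n → Set
    sym     : ∀ {u v} → Adj u v → Adj v u
    irrefl  : ∀ {v} → ¬ Adj v v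

open Graph public

NoIsolated : ∀ {n} → Graph n → Set
NoIsolated {n} G = ∀ (v : Fin n) → ∃[ u ] Adj G v u

InNbhd : ∀ {n} → Graph n → (Fin n → Set) → Fin n → Set
InNbhd G X v = ∃[ u ] (X u × Adj G u v)

-- Literals and assignments over variables x_0 … x_{n-1}
-- (x_v , true) is the literal x_v, (x_v , false) is ¬ x_v.

Lit : ℕ → Set
Lit n = Fin n × Bool

Assignment : ℕ → Set
Assignment n = Fin n → Bool

BoolFun : ℕ → Set₁
BoolFun n = Assignment n → Set

phi : ∀ {n} → Graph n → BoolFun n
phi G σ = ∀ u v → Adj G u v → (σ u ≡ true) ⊎ (σ v ≡ true)

Agrees : ∀ {n} → Assignment n → Lit n → Set
Agrees σ (x , b) = σ x ≡ b

-- Edge-labelled DAGs.  Nodes are Fin m, edges are Fin k (multiple edges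
-- allowed).  Acyclicity is encoded by a topological numbering:
-- every edge goes from a smaller to a larger node index.

record DAG (n : ℕ) : Set where
  field
    m k   : ℕ
    src   : Fin k → Fin m
    tgt   : Fin k → Fin m
    lab   : Fin k → Maybe (Lit n)
    topo  : ∀ e → toℕ (src e) < toℕ (tgt e)

open DAG public

data Path {n} (D : DAG n) : Fin (m D) → Fin (m D) → Set where
  []  : ∀ {a} → Path D a a
  _∷_ : ∀ {b} (e : Fin (k D)) → Path D (tgt D e) b → Path D (src D e) b

labels : ∀ {n} {D : DAG n} {a b} → Path D a b → List (Lit n)
labels [] = []
labels {D = D} (e ∷ P) with lab D e
... | just l  = l ∷ labels P
... | nothing = labels P

vars : ∀ {n} {D : DAG n} {a b} → Path D a b → List (Fin n)
vars P = map proj₁ (labels P)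

Extends : ∀ {n} {D : DAG n} {a b} → Assignment n → Path D a b → Set
Extends σ P = All (Agrees σ) (labels P)

record NROBP (n : ℕ) : Set where
  field
    dag        : DAG n
    root leaf  : Fin (m dag)
    root-noin  : ∀ e → tgt dag e ≢ root
    root-uniq  : ∀ a → a ≢ root → ∃[ e ] tgt dag e ≡ a
    leaf-noout : ∀ e → src dag e ≢ leaf
    leaf-uniq  : ∀ a → a ≢ leaf → ∃[ e ] src dag e ≡ a
    connected  : ∀ a → Path dag root a
    read-once  : ∀ {a b} (P : Path dag a b) → Unique (vars P)

open NROBP public

NodeOf : ∀ {n} → NROBP n → Set
NodeOf Y = Fin (m (dag Y))

RPath : ∀ {n} (Y : NROBP n) → NodeOf Y → NodeOf Y → Set
RPath Y = Path (dag Y)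

Realizes : ∀ {n} → NROBP n → BoolFun n → Set
Realizes Y F =
  (∀ (P : RPath Y (root Y) (leaf Y)) (σ : Assignment _) → Extends σ P → F σ)
  × (∀ (σ : Assignment _) → F σ → ∃[ P ] Extends {D = dag Y} {root Y} {leaf Y} σ P)

Uniform : ∀ {n} → NROBP n → Set
Uniform {n} Y =
  (∀ (a : NodeOf Y) (P Q : RPath Y (root Y) a) (x : Fin n) → (x ∈ vars P) ⇔ (x ∈ vars Q))
  × (∀ (P : RPath Y (root Y) (leaf Y)) (x : Fin n) → x ∈ vars P)

IsNFBDD : ∀ {n} → NROBP n → Set
IsNFBDD Y =
  (∀ e → ∃[ l ] lab (dag Y) e ≡ just l)
  × (∀ e₁ e₂ e₃ → src (dag Y) e₁ ≡ src (dag Y) e₂ → src (dag Y) e₁ ≡ src (dag Y) e₃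
        → e₁ ≢ e₂ → e₁ ≢ e₃ → e₂ ≢ e₃ → ⊥)
  × (∀ e₁ e₂ → src (dag Y) e₁ ≡ src (dag Y) e₂ → e₁ ≢ e₂
        → ∃[ x ] ∃[ b ] (lab (dag Y) e₁ ≡ just (x , b) × lab (dag Y) e₂ ≡ just (x , not b)))

Vert : ∀ {n} (Y : NROBP n) → NodeOf Y → Fin n → Set
Vert Y a v = ∀ (P : RPath Y (root Y) a) → v ∉ vars P

Free : ∀ {n} (Y : NROBP n) → NodeOf Y → Fin n → Set
Free Y a v = Vert Y a v × ∃[ Q ] ((v , false) ∈ labels {D = dag Y} {a} {leaf Y} Q)

Vrt : ∀ {n} {D : DAG n} {a b} → Path D a b → Fin n → Set
Vrt P v = v ∈ vars P

Vng : ∀ {n} {D : DAG n} {a b} → Path D a b → Fin n → Set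
Vng P v = (v , false) ∈ labels P

{-# OPTIONS --safe #-}
-- Every path from the root extends to an accepted path T, and the assignment that is false
-- exactly on the variables negated on T extends T (read-once), hence satisfies φ(G); so the
-- negated variables of a root path form an independent set of G, which gives
-- Free_a ⊆ V ∖ (Vrt ∪ N(Vng P₁)).  Conversely, for v outside that set the assignment false
-- exactly on {v} ∪ Vng P₁ satisfies φ(G) and is accepted along some path.  As the two
-- out-edges of a node carry opposite literals, that path runs along P₁ to a; by uniformity
-- x_v is not read before a but is read on the path, so after a, and there it reads ¬x_v.
module Submission where

open import Defs hiding (sym)
open import Data.Nat using (ℕ)
open import Data.Fin using (Fin)
open import Data.Product using (_×_)
open import Relation.Nullary using (¬_)
open import Function.Bundles using (_⇔_)

open import Data.Bool using (Bool; true; false; not)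
open import Data.Bool.Properties using (not-¬) renaming (_≟_ to _≟ᵇ_)
open import Data.Empty using (⊥; ⊥-elim)
open import Data.Fin as Fin using (_>_)
open import Data.Fin.Induction using (>-wellFounded)
open import Data.List using (List; _∷_; map; _++_)
open import Data.List.Membership.Propositional using (_∈_)
open import Data.List.Membership.Propositional.Properties using (∈-map⁻; ∈-++⁺ˡ; ∈-++⁺ʳ; ∈-++⁻)
import Data.List.Membership.DecPropositional as DecMembership
open import Data.List.Properties using (map-++)
open import Data.List.Relation.Unary.All as All using (All; _∷_)
open import Data.List.Relation.Unary.All.Properties using (map⁻; ++⁻ʳ; ¬Any⇒All¬)
open import Data.List.Relation.Unary.Any using (here; there)
open import Data.List.Relation.Unary.AllPairs using (_∷_)
open import Data.List.Relation.Unary.Unique.Propositional using (Unique)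
open import Data.Maybe using (just; nothing)
open import Data.Product using (∃-syntax; _,_; proj₁; proj₂; map₂)
open import Data.Product.Properties using (≡-dec)
open import Data.Sum using (_⊎_; inj₁; inj₂)
open import Function.Bundles using (mk⇔; Equivalence)
open import Induction.WellFounded using (Acc; acc)
open import Relation.Nullary using (yes; no; does)
open import Relation.Binary.PropositionalEquality using (_≡_; refl; sym; trans; cong; subst)

private
  variable
    n : ℕ

_++ₚ_ : {D : DAG n} {a b c : Fin (m D)} → Path D a b → Path D b c → Path D a c
[] ++ₚ Q = Q
(e ∷ P) ++ₚ Q = e ∷ (P ++ₚ Q)

labels-++ : {D : DAG n} {a b c : Fin (m D)} (P : Path D a b) (Q : Path D b c) →
            labels (P ++ₚ Q) ≡ labels P ++ labels Q
labels-++ [] Q = refl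
labels-++ {D = D} (e ∷ P) Q with lab D e
... | just l  = cong (l ∷_) (labels-++ P Q)
... | nothing = labels-++ P Q

Vng-++⁺ˡ : {D : DAG n} {a b c : Fin (m D)} (P : Path D a b) (Q : Path D b c) {v : Fin n} →
           Vng P v → Vng (P ++ₚ Q) v
Vng-++⁺ˡ P Q v∈P = subst (_ ∈_) (sym (labels-++ P Q)) (∈-++⁺ˡ v∈P)

Vng-++⁺ʳ : {D : DAG n} {a b c : Fin (m D)} (P : Path D a b) (Q : Path D b c) {v : Fin n} →
           Vng Q v → Vng (P ++ₚ Q) v
Vng-++⁺ʳ P Q v∈Q = subst (_ ∈_) (sym (labels-++ P Q)) (∈-++⁺ʳ (labels P) v∈Q)

Extends-∈-vars : {D : DAG n} {a b : Fin (m D)} {σ : Assignment n} (P : Path D a b) {v : Fin n} →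
                 Extends σ P → v ∈ vars P → (v , σ v) ∈ labels P
Extends-∈-vars P σ⊨P v∈P with ∈-map⁻ proj₁ v∈P
... | (v , b) , l∈P , refl = subst (λ c → (v , c) ∈ labels P) (sym (All.lookup σ⊨P l∈P)) l∈P

pathToLeaf : (Y : NROBP n) (a : NodeOf Y) → RPath Y a (leaf Y)
pathToLeaf Y a = go a (>-wellFounded a)
  where
  go : (a : NodeOf Y) → Acc _>_ a → RPath Y a (leaf Y)
  go a (acc rec) with a Fin.≟ leaf Y
  ... | yes refl = []
  ... | no a≢leaf with leaf-uniq Y a a≢leaf
  ...   | e , refl = e ∷ go (tgt (dag Y) e) (rec (topo (dag Y) e))

sign-unique : (L : List (Lit n)) → Unique (map proj₁ L) →
              {x : Fin n} {b b′ : Bool} → (x , b) ∈ L → (x , b′) ∈ L → b ≡ b′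
sign-unique (_ ∷ L) (_ ∷ _) (here refl) (here refl) = refl
sign-unique (_ ∷ L) (x∉L ∷ _) (here refl) (there l∈L) = ⊥-elim (All.lookup (map⁻ x∉L) l∈L refl)
sign-unique (_ ∷ L) (x∉L ∷ _) (there l∈L) (here refl) = ⊥-elim (All.lookup (map⁻ x∉L) l∈L refl)
sign-unique (_ ∷ L) (_ ∷ uniq) (there l∈L) (there l′∈L) = sign-unique L uniq l∈L l′∈L

module _ {n : ℕ} where
  open DecMembership (≡-dec (Fin._≟_ {n}) _≟ᵇ_) using (_∈?_)

  negAssignment : List (Lit n) → Assignment n
  negAssignment L x = not (does ((x , false) ∈? L))

  negAssignment-false⇔ : (L : List (Lit n)) (x : Fin n) →
                         negAssignment L x ≡ false ⇔ (x , false) ∈ L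
  negAssignment-false⇔ L x with (x , false) ∈? L
  ... | yes x̄∈L = mk⇔ (λ _ → x̄∈L) (λ _ → refl)
  ... | no x̄∉L  = mk⇔ (λ ()) (λ x̄∈L → ⊥-elim (x̄∉L x̄∈L))

  negAssignment-extends : (L : List (Lit n)) → Unique (map proj₁ L) → All (Agrees (negAssignment L)) L
  negAssignment-extends L uniq = All.tabulate agrees
    where
    agrees : {l : Lit n} → l ∈ L → Agrees (negAssignment L) l
    agrees {x , false} x̄∈L = Equivalence.from (negAssignment-false⇔ L x) x̄∈L
    agrees {x , true}  x∈L with negAssignment L x in σx
    ... | true  = refl
    ... | false = sym (sign-unique L uniq x∈L (Equivalence.to (negAssignment-false⇔ L x) σx))

Extends-head : {D : DAG n} {b : Fin (m D)} {σ : Assignment n} (e : Fin (k D)) (P : Path D (tgt D e) b)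
               {l : Lit n} → lab D e ≡ just l → Extends σ (e ∷ P) → Agrees σ l
Extends-head {D = D} e P lab≡ σ⊨eP with lab D e | lab≡ | σ⊨eP
... | just _ | refl | σ⊨l ∷ _ = σ⊨l

module _ (Y : NROBP n) (nfbdd : IsNFBDD Y) {σ : Assignment n} where
  private
    D : DAG n
    D = dag Y

  consistent-prefix : {c a : NodeOf Y} (R : RPath Y c a) (S : RPath Y c (leaf Y)) →
                      Extends σ R → Extends σ S →
                      ∃[ Q ] labels S ≡ labels R ++ labels {D = D} {a} {leaf Y} Q
  consistent-prefix R S = go R S refl
    where
    go : {c c′ a : NodeOf Y} (R : RPath Y c a) (S : RPath Y c′ (leaf Y)) → c ≡ c′ →
         Extends σ R → Extends σ S → ∃[ Q ] labels S ≡ labels R ++ labels {D = D} {a} {leaf Y} Q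
    go [] S refl _ _ = S , refl
    go (e ∷ R) [] c≡c′ _ _ = ⊥-elim (leaf-noout Y e c≡c′)
    go (e ∷ R) (e′ ∷ S) c≡c′ σ⊨eR σ⊨e′S with e Fin.≟ e′
    ... | yes refl with lab D e | σ⊨eR | σ⊨e′S
    ...   | just l  | _ ∷ σ⊨R | _ ∷ σ⊨S = map₂ (cong (l ∷_)) (go R S refl σ⊨R σ⊨S)
    ...   | nothing | σ⊨R     | σ⊨S     = go R S refl σ⊨R σ⊨S
    go (e ∷ R) (e′ ∷ S) c≡c′ σ⊨eR σ⊨e′S | no e≢e′ with proj₂ (proj₂ nfbdd) e e′ c≡c′ e≢e′
    ... | _ , _ , lab≡ , lab≡′ = ⊥-elim (not-¬ (Extends-head e R lab≡ σ⊨eR) (Extends-head e′ S lab≡′ σ⊨e′S))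

zeros-independent⇒phi : (G : Graph n) (σ : Assignment n) →
                        ({x y : Fin n} → σ x ≡ false → σ y ≡ false → ¬ Adj G x y) → phi G σ
zeros-independent⇒phi G σ independent x y x~y with σ x in σx | σ y in σy
... | true  | _     = inj₁ refl
... | false | true  = inj₂ refl
... | false | false = ⊥-elim (independent σx σy x~y)

module _ (G : Graph n) (Y : NROBP n) (realizes : Realizes Y (phi G)) where

  Vng-independent : {a : NodeOf Y} (P : RPath Y (root Y) a) {u w : Fin n} →
                    Vng P u → Vng P w → ¬ Adj G u w
  Vng-independent {a} P {u} {w} ū∈P w̄∈P u~w = clause-falsified (proj₁ realizes T σ σ⊨T u w u~w)
    where
    T : RPath Y (root Y) (leaf Y)
    T = P ++ₚ pathToLeaf Y a

    σ : Assignment n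
    σ = negAssignment (labels T)

    σ⊨T : Extends σ T
    σ⊨T = negAssignment-extends (labels T) (read-once Y T)

    false-on-P : {x : Fin n} → Vng P x → σ x ≡ false
    false-on-P x̄∈P = Equivalence.from (negAssignment-false⇔ (labels T) _) (Vng-++⁺ˡ P _ x̄∈P)

    clause-falsified : σ u ≡ true ⊎ σ w ≡ true → ⊥
    clause-falsified (inj₁ σu) = not-¬ σu (false-on-P ū∈P)
    clause-falsified (inj₂ σw) = not-¬ σw (false-on-P w̄∈P)

  Free⇒avoids : {a : NodeOf Y} (P₁ : RPath Y (root Y) a) {v : Fin n} →
                Free Y a v → ¬ Vrt P₁ v × ¬ InNbhd G (Vng P₁) v
  Free⇒avoids P₁ (vert , Q , v̄∈Q) =
    vert P₁ , λ (u , ū∈P₁ , u~v) → Vng-independent (P₁ ++ₚ Q) (Vng-++⁺ˡ P₁ Q ū∈P₁) (Vng-++⁺ʳ P₁ Q v̄∈Q) u~v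

  negAssignment-∷-satisfies : {a : NodeOf Y} (P₁ : RPath Y (root Y) a) {v : Fin n} →
                              ¬ InNbhd G (Vng P₁) v → phi G (negAssignment ((v , false) ∷ labels P₁))
  negAssignment-∷-satisfies P₁ {v} v∉N = zeros-independent⇒phi G σ zeros-independent
    where
    L : List (Lit n)
    L = (v , false) ∷ labels P₁

    σ : Assignment n
    σ = negAssignment L

    zeros-independent : {x y : Fin n} → σ x ≡ false → σ y ≡ false → ¬ Adj G x y
    zeros-independent {x} {y} σx σy x~y
      with Equivalence.to (negAssignment-false⇔ L x) σx | Equivalence.to (negAssignment-false⇔ L y) σy
    ... | here refl  | here refl  = irrefl G x~y
    ... | here refl  | there ȳ∈P₁ = v∉N (y , ȳ∈P₁ , Graph.sym G x~y)
    ... | there x̄∈P₁ | here refl  = v∉N (x , x̄∈P₁ , x~y)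
    ... | there x̄∈P₁ | there ȳ∈P₁ = Vng-independent P₁ x̄∈P₁ ȳ∈P₁ x~y

  module _ (nfbdd : IsNFBDD Y) (uniform : Uniform Y) where

    avoids⇒Free : {a : NodeOf Y} (P₁ : RPath Y (root Y) a) {v : Fin n} →
                  ¬ Vrt P₁ v × ¬ InNbhd G (Vng P₁) v → Free Y a v
    avoids⇒Free {a} P₁ {v} (v∉P₁ , v∉N) = vert , Q , v̄∈Q
      where
      vert : Vert Y a v
      vert P v∈P = v∉P₁ (Equivalence.to (proj₁ uniform a P P₁ v) v∈P)

      σ : Assignment n
      σ = negAssignment ((v , false) ∷ labels P₁)

      σ⊨v̄P₁ : All (Agrees σ) ((v , false) ∷ labels P₁)
      σ⊨v̄P₁ = negAssignment-extends _ (¬Any⇒All¬ (vars P₁) v∉P₁ ∷ read-once Y P₁)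

      accepted : ∃[ P ] Extends {D = dag Y} {root Y} {leaf Y} σ P
      accepted = proj₂ realizes σ (negAssignment-∷-satisfies P₁ v∉N)

      P : RPath Y (root Y) (leaf Y)
      P = proj₁ accepted

      split : ∃[ Q ] labels P ≡ labels P₁ ++ labels {D = dag Y} {a} {leaf Y} Q
      split = consistent-prefix Y nfbdd P₁ P (All.tail σ⊨v̄P₁) (proj₂ accepted)

      Q : RPath Y a (leaf Y)
      Q = proj₁ split

      σ⊨Q : Extends σ Q
      σ⊨Q = ++⁻ʳ (labels P₁) (subst (All (Agrees σ)) (proj₂ split) (proj₂ accepted))

      vars-split : vars P ≡ vars P₁ ++ vars Q
      vars-split = trans (cong (map proj₁) (proj₂ split)) (map-++ proj₁ (labels P₁) (labels Q))

      v∈Q : v ∈ vars Q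
      v∈Q with ∈-++⁻ (vars P₁) (subst (v ∈_) vars-split (proj₂ uniform P v))
      ... | inj₁ v∈P₁ = ⊥-elim (v∉P₁ v∈P₁)
      ... | inj₂ v∈Q  = v∈Q

      v̄∈Q : Vng Q v
      v̄∈Q = subst (λ b → (v , b) ∈ labels Q) (All.head σ⊨v̄P₁) (Extends-∈-vars Q σ⊨Q v∈Q)

lemma11 : ∀ {n} (G : Graph n) → NoIsolated G
          → (Y : NROBP n) → IsNFBDD Y → Uniform Y → Realizes Y (phi G)
          → (a : NodeOf Y) (P₁ : RPath Y (root Y) a)
          → ∀ (v : Fin n) → Free Y a v ⇔ (¬ Vrt P₁ v × ¬ InNbhd G (Vng P₁) v)
lemma11 G _ Y nfbdd uniform realizes a P₁ v =
  mk⇔ (Free⇒avoids G Y realizes P₁) (avoids⇒Free G Y realizes nfbdd uniform P₁)
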